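{- Let $w$ be a highest weight vertex of $\Gamma$ (i.e. $\tilde e_1(w)=\tilde e_2(w)=0$). Then $\mathrm{w}(P(w))\equiv w$.
   Context: Let $\mathcal{G}=\{1,2,3,0,\bar3,\bar2,\bar1\}$, totally ordered by $1\prec2\prec3\prec0\prec\bar3\prec\bar2\prec\bar1$. $B(\Lambda_1)$ is the $U_q(G_2)$-crystal with vertices $\mathcal{G}$ and arrows $1\xrightarrow{1}2\xrightarrow{2}3\xrightarrow{1}0\xrightarrow{1}\bar3\xrightarrow{2}\bar2\xrightarrow{1}\bar1$ ($a\xrightarrow{i}b$ means $\tilde f_i a=b$, $\tilde e_i b=a$; all other applications of $\tilde e_i,\tilde f_i$ give $0$); $\varepsilon_i(u)=\max\{k:\tilde e_i^ku\ne0\}$, $\varphi_i(u)=\max\{k:\tilde f_i^ku\ne0\}$. Words $x_1\cdots x_l$ over $\mathcal{G}$ are identified with vertices $x_1\otimes\cdots\otimes x_l$ of $\Gamma=\bigoplus_{l\ge0}B(\Lambda_1)^{\otimes l}$, with $\tilde f_i(u\otimes v)=\tilde f_iu\otimes v$ if $\varphi_i(u)>\varepsilon_i(v)$, else $u\otimes\tilde f_iv$; $\tilde e_i(u\otimes v)=u\otimes\tilde e_iv$ if $\varphi_i(u)<\varepsilon_i(v)$, else $\tilde e_iu\otimes v$. $B(w)$ is the connected component of $\Gamma$ containing $w$. $w_1\sim w_2$ means there is a crystal isomorphism $B(w_1)\to B(w_2)$ sending $w_1$ to $w_2$. Tableaux of type $G_2$: let $\mathrm{dist}(a,b)$ be the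 number of arrows between $a$ and $b$ in the chain above. A column is either a single box $[a]$, $a\in\mathcal{G}$, or two boxes with top $a$ and bottom $b$ where $a\prec b$ or $a=b=0$; its reading $\mathrm{w}(C)$ is the word read top to bottom. A height-1 column is admissible; a height-2 column $(a,b)$ is admissible if $\mathrm{dist}(a,b)\le2$ when $a\in\{1,0\}$ and $\mathrm{dist}(a,b)\le3$ otherwise. For admissible columns, $C_1\preceq C_2$ means one of: (i) $C_1=[a],C_2=[b]$ with $a\preceq b$, $(a,b)\ne(0,0)$; (ii) $C_1=(a,b)$ of height 2, $C_2=[c]$, with $a\preceq c$, $(a,c)\neq(0,0)$; (iii) $C_1=(a,b)$, $C_2=(c,d)$ both of height 2, with $a\preceq c$, $(a,c)\ne(0,0)$, $b\preceq d$, $(b,d)\ne(0,0)$, and $\mathrm{dist}(a,d)\ge3$ if $a\in\{2,3,0\}$, $\mathrm{dist}(a,d)\ge2$ if $a=\bar3$. For $\lambda=\lambda_1\Lambda_1+\lambda_2\Lambda_2$ ($\lambda_i\in\mathbb{Z}_{\ge0}$), $Y(\lambda)$ is the Young diagram with $\lambda_2$ columns of height 2 followed by $\lambda_1$ columns of height 1. A tableau of type $G_2$ of shape $\lambda$ is a filling $T=C_1\cdots C_s$ of $Y(\lambda)$ by admissible columns with $C_i\preceq C_{i+1}$; its reading is $\mathrm{w}(T)=\mathrm{w}(C_s)\cdots\mathrm{w}(C_1)$. By Kang–Misra, for every word $w$ there is a unique tableau of type $G_2$, denoted $P(w)$, with $w\sim\mathrm{w}(P(w))$. The congruence $\equiv$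 on $\mathcal{G}^*$ (plactic monoid $Pl(G_2)$) is the smallest congruence containing: (R1) $10\equiv1$, $1\bar3\equiv2$, $1\bar2\equiv3$, $2\bar2\equiv0$, $0\bar1\equiv\bar1$, $3\bar1\equiv\bar2$, $2\bar1\equiv\bar3$; (R2) $1\bar1\equiv\emptyset$; (R3) $u\equiv\xi_3(u)$ for $u\in B(121)$, $\xi_3:B(121)\to B(112)$ the crystal isomorphism; (R4) $u\equiv\xi_4(u)$ for $u\in B(123)$, $\xi_4:B(123)\to B(110)$ the crystal isomorphism. -}

module Defs where

open import Data.Nat using (ℕ; zero; suc; _+_; _*_; _≤_; _<_; _<ᵇ_; ∣_-_∣)
open import Data.Bool using (if_then_else_)
open import Data.List using (List; []; _∷_; _++_; map; concat; reverse; replicate)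
open import Data.List.Relation.Unary.All using (All)
open import Data.List.Relation.Unary.Linked using (Linked)
open import Data.Vec using (Vec; []; _∷_; fromList; toList)
open import Data.Maybe using (Maybe; nothing; just) renaming (map to mapMaybe)
open import Data.Product using (Σ; _×_; _,_)
open import Data.Sum using (_⊎_)
open import Relation.Binary.PropositionalEquality using (_≡_)
open import Relation.Nullary using (¬_)
open import Data.Unit using (⊤)

-- The alphabet 𝒢 = {1,2,3,0,3̄,2̄,1̄}

data G : Set where
  g1 g2 g3 g0 g3b g2b g1b : G

idx : G → ℕ
idx g1  = 0
idx g2  = 1
idx g3  = 2
idx g0  = 3
idx g3b = 4
idx g2b = 5
idx g1b = 6

_≺_ : G → G → Set
a ≺ b = idx a < idx b

_≼_ : G → G → Set
a ≼ b = idx a ≤ idx b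

-- number of arrows between a and b in the chain
dist : G → G → ℕ
dist a b = ∣ idx a - idx b ∣

-- The crystal B(Λ₁)

data I : Set where
  α1 α2 : I

fL : I → G → Maybe G
fL α1 g1  = just g2
fL α1 g3  = just g0
fL α1 g0  = just g3b
fL α1 g2b = just g1b
fL α2 g2  = just g3
fL α2 g3b = just g2b
fL _  _   = nothing

eL : I → G → Maybe G
eL α1 g2  = just g1
eL α1 g0  = just g3
eL α1 g3b = just g0
eL α1 g1b = just g2b
eL α2 g3  = just g2
eL α2 g2b = just g3b
eL _  _   = nothing

count : {A : Set} → ℕ → (A → Maybe A) → A → ℕ
count zero    h a = 0
count (suc k) h a with h a
... | nothing = 0
... | just a' = suc (count k h a')

-- φ_i(a) = max{k : f_i^k a ≠ 0}; fuel 6 is exact since the chain has 6 arrows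
φL : I → G → ℕ
φL i a = count 6 (fL i) a

-- Tensor powers: a word x₁⋯x_l is x₁ ⊗ (x₂ ⊗ ⋯ ⊗ x_l).
-- ε_i of a word is max{k : ẽ_i^k w ≠ 0}, computed by iteration with fuel
-- 6·length (exact, since ε_i(u ⊗ v) ≤ ε_i(u) + ε_i(v) and ε_i(letter) ≤ 6).

mutual
  eV : (n : ℕ) → I → Vec G n → Maybe (Vec G n)
  eV zero    i []      = nothing
  eV (suc n) i (x ∷ v) =
    if φL i x <ᵇ εV n i v
      then mapMaybe (x ∷_) (eV n i v)
      else mapMaybe (_∷ v) (eL i x)

  iterE : (n : ℕ) → I → ℕ → Vec G n → ℕ
  iterE n i zero    v = 0
  iterE n i (suc k) v = iterE' n i k (eV n i v)

  iterE' : (n : ℕ) → I → ℕ → Maybe (Vec G n) → ℕ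
  iterE' n i k nothing   = 0
  iterE' n i k (just v') = suc (iterE n i k v')

  εV : (n : ℕ) → I → Vec G n → ℕ
  εV n i v = iterE n i (6 * n) v

fV : (n : ℕ) → I → Vec G n → Maybe (Vec G n)
fV zero    i []      = nothing
fV (suc n) i (x ∷ v) =
  if εV n i v <ᵇ φL i x
    then mapMaybe (_∷ v) (fL i x)
    else mapMaybe (x ∷_) (fV n i v)

Word : Set
Word = List G

-- Kashiwara operators on Γ = ⊕_l B(Λ₁)^{⊗l}  (nothing = 0)
ẽ : I → Word → Maybe Word
ẽ i w = mapMaybe toList (eV _ i (fromList w))

f̃ : I → Word → Maybe Word
f̃ i w = mapMaybe toList (fV _ i (fromList w))

HighestWeight : Word → Set
HighestWeight w = (ẽ α1 w ≡ nothing) × (ẽ α2 w ≡ nothing)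

data InB (w : Word) : Word → Set where
  here : InB w w
  viaE : ∀ {u v} i → InB w u → ẽ i u ≡ just v → InB w v
  viaF : ∀ {u v} i → InB w u → f̃ i u ≡ just v → InB w v

record CrystalIso (w₁ w₂ : Word) (F : Word → Word) : Set where
  field
    into   : ∀ u → InB w₁ u → InB w₂ (F u)
    sends  : F w₁ ≡ w₂
    inj    : ∀ u u' → InB w₁ u → InB w₁ u' → F u ≡ F u' → u ≡ u'
    surj   : ∀ v → InB w₂ v → Σ Word (λ u → InB w₁ u × F u ≡ v)
    e-comm : ∀ i u → InB w₁ u → ẽ i (F u) ≡ mapMaybe F (ẽ i u)
    f-comm : ∀ i u → InB w₁ u → f̃ i (F u) ≡ mapMaybe F (f̃ i u)

_∼_ : Word → Word → Set
w₁ ∼ w₂ = Σ (Word → Word) (CrystalIso w₁ w₂)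

data Col : Set where
  col1 : G → Col
  col2 : G → G → Col     -- top, bottom

height : Col → ℕ
height (col1 _)   = 1
height (col2 _ _) = 2

colWord : Col → Word
colWord (col1 a)   = a ∷ []
colWord (col2 a b) = a ∷ b ∷ []

Not00 : G → G → Set
Not00 a b = ¬ ((a ≡ g0) × (b ≡ g0))

data Admissible : Col → Set where
  adm1   : ∀ a → Admissible (col1 a)
  adm2-1 : ∀ {a b} → (a ≺ b ⊎ (a ≡ g0 × b ≡ g0)) → a ≡ g1 → dist a b ≤ 2 → Admissible (col2 a b)
  adm2-0 : ∀ {a b} → (a ≺ b ⊎ (a ≡ g0 × b ≡ g0)) → a ≡ g0 → dist a b ≤ 2 → Admissible (col2 a b)
  adm2-o : ∀ {a b} → (a ≺ b ⊎ (a ≡ g0 × b ≡ g0)) → ¬ (a ≡ g1) → ¬ (a ≡ g0) → dist a b ≤ 3 → Admissible (col2 a b)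

DistCond : G → G → Set
DistCond g2  d = 3 ≤ dist g2 d
DistCond g3  d = 3 ≤ dist g3 d
DistCond g0  d = 3 ≤ dist g0 d
DistCond g3b d = 2 ≤ dist g3b d
DistCond _   _ = ⊤

data _⪯_ : Col → Col → Set where
  case-i   : ∀ {a b} → a ≼ b → Not00 a b → col1 a ⪯ col1 b
  case-ii  : ∀ {a b c} → a ≼ c → Not00 a c → col2 a b ⪯ col1 c
  case-iii : ∀ {a b c d} → a ≼ c → Not00 a c → b ≼ d → Not00 b d →
             DistCond a d → col2 a b ⪯ col2 c d

record IsTableau (λ₁ λ₂ : ℕ) (T : List Col) : Set where
  field
    shape      : map height T ≡ replicate λ₂ 2 ++ replicate λ₁ 1
    admissible : All Admissible T
    rows       : Linked _⪯_ T

reading : List Col → Word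
reading T = concat (map colWord (reverse T))

data Gen : Word → Word → Set where
  r1a : Gen (g1 ∷ g0 ∷ [])  (g1 ∷ [])
  r1b : Gen (g1 ∷ g3b ∷ []) (g2 ∷ [])
  r1c : Gen (g1 ∷ g2b ∷ []) (g3 ∷ [])
  r1d : Gen (g2 ∷ g2b ∷ []) (g0 ∷ [])
  r1e : Gen (g0 ∷ g1b ∷ []) (g1b ∷ [])
  r1f : Gen (g3 ∷ g1b ∷ []) (g2b ∷ [])
  r1g : Gen (g2 ∷ g1b ∷ []) (g3b ∷ [])
  r2  : Gen (g1 ∷ g1b ∷ []) []
  r3  : (ξ₃ : Word → Word) → CrystalIso (g1 ∷ g2 ∷ g1 ∷ []) (g1 ∷ g1 ∷ g2 ∷ []) ξ₃ →
        ∀ u → InB (g1 ∷ g2 ∷ g1 ∷ []) u → Gen u (ξ₃ u)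
  r4  : (ξ₄ : Word → Word) → CrystalIso (g1 ∷ g2 ∷ g3 ∷ []) (g1 ∷ g1 ∷ g0 ∷ []) ξ₄ →
        ∀ u → InB (g1 ∷ g2 ∷ g3 ∷ []) u → Gen u (ξ₄ u)

data _≡ₚ_ : Word → Word → Set where
  gen    : ∀ {u v} → Gen u v → u ≡ₚ v
  prefl  : ∀ {u} → u ≡ₚ u
  psym   : ∀ {u v} → u ≡ₚ v → v ≡ₚ u
  ptrans : ∀ {u v w} → u ≡ₚ v → v ≡ₚ w → u ≡ₚ w
  pctx   : ∀ {u v} x y → u ≡ₚ v → (x ++ u ++ y) ≡ₚ (x ++ v ++ y)

{-# OPTIONS --safe #-}
module Submission where

-- For each i, the pair (ε_i, φ_i) of a word is obtained from those of its letters by the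
-- tensor product rule, an associative operation on ℕ × ℕ. Building a highest weight word
-- letter by letter, every prefix is again of highest weight, and appending a letter x to
-- 1^a (12)^b while staying of highest weight yields, by the relations R1–R4, a word
-- plactic-equivalent to 1^a′ (12)^b′ with a′, b′ given by the tensor product rule. Hence a
-- highest weight word w satisfies w ≡ 1^φ₁(w) (12)^φ₂(w). A crystal isomorphism preserves
-- highest weight and φ_i, so w(P(w)) is equivalent to the same word.

open import Defs
open import Data.Nat using (ℕ)
open import Data.List using (List)
open import Data.Nat using (zero; suc; _+_; _*_; _∸_; _≤_; _<_; _<ᵇ_; _⊓_; z≤n; s≤s; s≤s⁻¹; _≟_)
open import Data.Nat.Properties
open import Data.List using ([]; _∷_; _++_; map)
open import Data.List.Properties using (++-identityʳ)
import Data.List.Properties as List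
open import Data.List.Relation.Unary.All as All using (All; all?)
open import Data.List.Relation.Unary.Any using (here)
open import Data.List.Membership.Propositional using (_∈_)
open import Data.Vec using (Vec; []; _∷_; fromList; toList)
open import Data.Vec.Properties using (toList∘fromList)
open import Data.Maybe using (Maybe; nothing; just) renaming (map to mapMaybe)
import Data.Maybe.Properties as Maybe
open import Data.Maybe.Properties using (just-injective)
open import Data.Maybe.Relation.Unary.All as MaybeAll using () renaming (All to MaybeAll)
open import Data.Bool using (if_then_else_)
open import Data.Product using (Σ; _×_; _,_; proj₁; proj₂; swap)
open import Data.Sum using (inj₁; inj₂)
open import Function using (_∘_)
open import Relation.Nullary using (contradiction)
open import Relation.Nullary.Decidable using (Dec; does; map′; _×-dec_; from-yes)
open import Relation.Nullary.Reflects using (Reflects; ofʸ; ofⁿ)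
open import Relation.Binary.Bundles using (Setoid)
open import Relation.Binary.Definitions using (DecidableEquality)
import Relation.Binary.Reasoning.Setoid
open import Relation.Binary.PropositionalEquality
  using (_≡_; refl; sym; trans; cong; cong₂; subst; subst₂; module ≡-Reasoning)

-- Signatures and the tensor product rule

-- The pair (ε_i u, φ_i u) of a crystal element u; _⊗_ computes it for u ⊗ v.
record Sig : Set where
  constructor ⟨_,_⟩
  field
    ε φ : ℕ
open Sig

infixr 6 _⊗_
_⊗_ : Sig → Sig → Sig
s ⊗ t = ⟨ ε s + (ε t ∸ φ s) , φ t + (φ s ∸ ε t) ⟩

+∸-distrib : ∀ x y m n → x + (n ∸ y) ∸ m ≡ (x ∸ m) + (n ∸ (y + (m ∸ x)))
+∸-distrib x y m n with ≤-total m x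
... | inj₁ m≤x = begin
  x + (n ∸ y) ∸ m               ≡⟨ +-∸-comm (n ∸ y) m≤x ⟩
  (x ∸ m) + (n ∸ y)             ≡⟨ cong (λ k → x ∸ m + (n ∸ k)) (sym (+-identityʳ y)) ⟩
  (x ∸ m) + (n ∸ (y + 0))       ≡⟨ cong (λ k → x ∸ m + (n ∸ (y + k))) (sym (m≤n⇒m∸n≡0 m≤x)) ⟩
  (x ∸ m) + (n ∸ (y + (m ∸ x))) ∎
  where open ≡-Reasoning
... | inj₂ x≤m = begin
  x + (n ∸ y) ∸ m                 ≡⟨ cong (x + (n ∸ y) ∸_) (sym (m+[n∸m]≡n x≤m)) ⟩
  x + (n ∸ y) ∸ (x + (m ∸ x))     ≡⟨ [m+n]∸[m+o]≡n∸o x (n ∸ y) (m ∸ x) ⟩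
  n ∸ y ∸ (m ∸ x)                 ≡⟨ ∸-+-assoc n y (m ∸ x) ⟩
  n ∸ (y + (m ∸ x))               ≡⟨ cong (_+ (n ∸ (y + (m ∸ x)))) (sym (m≤n⇒m∸n≡0 x≤m)) ⟩
  (x ∸ m) + (n ∸ (y + (m ∸ x)))   ∎
  where open ≡-Reasoning

⊗-assoc : ∀ s t u → (s ⊗ t) ⊗ u ≡ s ⊗ (t ⊗ u)
⊗-assoc s t u = cong₂ ⟨_,_⟩
  (trans (+-assoc (ε s) _ _) (cong (ε s +_) (sym (+∸-distrib (ε t) (φ t) (φ s) (ε u)))))
  (trans (cong (φ u +_) (+∸-distrib (φ t) (ε t) (ε u) (φ s))) (sym (+-assoc (φ u) _ _)))

⊗-identityˡ : ∀ s → ⟨ 0 , 0 ⟩ ⊗ s ≡ s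
⊗-identityˡ s = cong ⟨ ε s ,_⟩ (trans (cong (φ s +_) (0∸n≡0 (ε s))) (+-identityʳ (φ s)))

ε-prefix-zero : ∀ s t u → ε (s ⊗ t ⊗ u) ≡ 0 → ε (s ⊗ t) ≡ 0
ε-prefix-zero s t u h = m+n≡0⇒m≡0 (ε (s ⊗ t)) (trans (cong ε (⊗-assoc s t u)) h)

absorb : ∀ s t u → ε (s ⊗ t ⊗ u) ≡ 0 → s ⊗ t ⊗ u ≡ ⟨ 0 , φ (s ⊗ t) ⟩ ⊗ u
absorb s t u h = trans (sym (⊗-assoc s t u)) (cong (λ e → ⟨ e , φ (s ⊗ t) ⟩ ⊗ u) (ε-prefix-zero s t u h))

-- Applying ẽ_i to an element of signature s gives one of signature t.
infix 4 _⇝_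
_⇝_ : Sig → Sig → Set
s ⇝ t = ε s ≡ suc (ε t) × φ t ≡ suc (φ s)

suc-∸ : ∀ {m n} → m ≤ n → suc n ∸ m ≡ suc (n ∸ m)
suc-∸ = +-∸-assoc 1

⊗-⇝ˡ : ∀ {s s′ t} → ε t ≤ φ s → s ⇝ s′ → s ⊗ t ⇝ s′ ⊗ t
⊗-⇝ˡ {s} {s′} {t} εt≤φs (εs≡ , φs′≡) = ε-step , φ-step
  where
  open ≡-Reasoning
  εt≤φs′ : ε t ≤ φ s′
  εt≤φs′ = subst (ε t ≤_) (sym φs′≡) (m≤n⇒m≤1+n εt≤φs)
  ε-step : ε s + (ε t ∸ φ s) ≡ suc (ε s′ + (ε t ∸ φ s′))
  ε-step = begin
    ε s + (ε t ∸ φ s)         ≡⟨ cong₂ _+_ εs≡ (m≤n⇒m∸n≡0 εt≤φs) ⟩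
    suc (ε s′) + 0            ≡⟨ cong (suc (ε s′) +_) (sym (m≤n⇒m∸n≡0 εt≤φs′)) ⟩
    suc (ε s′ + (ε t ∸ φ s′)) ∎
  φ-step : φ t + (φ s′ ∸ ε t) ≡ suc (φ t + (φ s ∸ ε t))
  φ-step = begin
    φ t + (φ s′ ∸ ε t)       ≡⟨ cong (λ k → φ t + (k ∸ ε t)) φs′≡ ⟩
    φ t + (suc (φ s) ∸ ε t)  ≡⟨ cong (φ t +_) (suc-∸ εt≤φs) ⟩
    φ t + suc (φ s ∸ ε t)    ≡⟨ +-suc (φ t) _ ⟩
    suc (φ t + (φ s ∸ ε t))  ∎

⊗-⇝ʳ : ∀ {s t t′} → φ s < ε t → t ⇝ t′ → s ⊗ t ⇝ s ⊗ t′
⊗-⇝ʳ {s} {t} {t′} φs<εt (εt≡ , φt′≡) = ε-step , φ-step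
  where
  open ≡-Reasoning
  φs≤εt′ : φ s ≤ ε t′
  φs≤εt′ = s≤s⁻¹ (subst (φ s <_) εt≡ φs<εt)
  ε-step : ε s + (ε t ∸ φ s) ≡ suc (ε s + (ε t′ ∸ φ s))
  ε-step = begin
    ε s + (ε t ∸ φ s)         ≡⟨ cong (λ k → ε s + (k ∸ φ s)) εt≡ ⟩
    ε s + (suc (ε t′) ∸ φ s)  ≡⟨ cong (ε s +_) (suc-∸ φs≤εt′) ⟩
    ε s + suc (ε t′ ∸ φ s)    ≡⟨ +-suc (ε s) _ ⟩
    suc (ε s + (ε t′ ∸ φ s))  ∎
  φ-step : φ t′ + (φ s ∸ ε t′) ≡ suc (φ t + (φ s ∸ ε t))
  φ-step = begin
    φ t′ + (φ s ∸ ε t′)       ≡⟨ cong₂ _+_ φt′≡ (m≤n⇒m∸n≡0 φs≤εt′) ⟩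
    suc (φ t) + 0             ≡⟨ cong (suc (φ t) +_) (sym (m≤n⇒m∸n≡0 (<⇒≤ φs<εt))) ⟩
    suc (φ t + (φ s ∸ ε t))   ∎

ε-⊗-zero : ∀ s t → ε t ≤ φ s → ε s ≡ 0 → ε (s ⊗ t) ≡ 0
ε-⊗-zero s t εt≤φs εs≡0 = cong₂ _+_ εs≡0 (m≤n⇒m∸n≡0 εt≤φs)

φ-⊗-zero : ∀ s t → φ s ≤ ε t → φ t ≡ 0 → φ (s ⊗ t) ≡ 0
φ-⊗-zero s t φs≤εt φt≡0 = cong₂ _+_ φt≡0 (m≤n⇒m∸n≡0 φs≤εt)

-- ẽ_i and f̃_i on words

εL : I → G → ℕ
εL i = count 6 (eL i)

sigL : I → G → Sig
sigL i x = ⟨ εL i x , φL i x ⟩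

sig : I → Word → Sig
sig i []      = ⟨ 0 , 0 ⟩
sig i (x ∷ w) = sigL i x ⊗ sig i w

ESpec : {A : Set} → (A → Sig) → A → Maybe A → Set
ESpec σ a nothing   = ε (σ a) ≡ 0
ESpec σ a (just a′) = σ a ⇝ σ a′

FSpec : {A : Set} → (A → Sig) → A → Maybe A → Set
FSpec σ a nothing   = φ (σ a) ≡ 0
FSpec σ a (just a′) = σ a′ ⇝ σ a

ESpec-map : ∀ {A B : Set} {σ : B → Sig} (g : A → B) {a} m → ESpec (σ ∘ g) a m → ESpec σ (g a) (mapMaybe g m)
ESpec-map g nothing  h = h
ESpec-map g (just _) h = h

FSpec-map : ∀ {A B : Set} {σ : B → Sig} (g : A → B) {a} m → FSpec (σ ∘ g) a m → FSpec σ (g a) (mapMaybe g m)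
FSpec-map g nothing  h = h
FSpec-map g (just _) h = h

eL-spec : ∀ i x → ESpec (sigL i) x (eL i x)
eL-spec α1 g1  = refl
eL-spec α1 g2  = refl , refl
eL-spec α1 g3  = refl
eL-spec α1 g0  = refl , refl
eL-spec α1 g3b = refl , refl
eL-spec α1 g2b = refl
eL-spec α1 g1b = refl , refl
eL-spec α2 g1  = refl
eL-spec α2 g2  = refl
eL-spec α2 g3  = refl , refl
eL-spec α2 g0  = refl
eL-spec α2 g3b = refl
eL-spec α2 g2b = refl , refl
eL-spec α2 g1b = refl

fL-spec : ∀ i x → FSpec (sigL i) x (fL i x)
fL-spec α1 g1  = refl , refl
fL-spec α1 g2  = refl
fL-spec α1 g3  = refl , refl
fL-spec α1 g0  = refl , refl
fL-spec α1 g3b = refl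
fL-spec α1 g2b = refl , refl
fL-spec α1 g1b = refl
fL-spec α2 g1  = refl
fL-spec α2 g2  = refl , refl
fL-spec α2 g3  = refl
fL-spec α2 g0  = refl
fL-spec α2 g3b = refl , refl
fL-spec α2 g2b = refl
fL-spec α2 g1b = refl

count-≤ : ∀ {A : Set} k (h : A → Maybe A) a → count k h a ≤ k
count-≤ zero    h a = z≤n
count-≤ (suc k) h a with h a
... | nothing = z≤n
... | just a′ = s≤s (count-≤ k h a′)

ε-sig-≤ : ∀ {n} i (v : Vec G n) → ε (sig i (toList v)) ≤ 6 * n
ε-sig-≤ i [] = z≤n
ε-sig-≤ {suc n} i (x ∷ v) = begin
  εL i x + (ε (sig i (toList v)) ∸ φL i x)
    ≤⟨ +-mono-≤ (count-≤ 6 (eL i) x) (m∸n≤m (ε (sig i (toList v))) (φL i x)) ⟩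
  6 + ε (sig i (toList v))                 ≤⟨ +-monoʳ-≤ 6 (ε-sig-≤ i v) ⟩
  6 + 6 * n                                ≡⟨ *-suc 6 n ⟨
  6 * suc n                                ∎
  where open ≤-Reasoning

e-left : ∀ i x {n} (v : Vec G n) → ε (sig i (toList v)) ≤ φL i x →
         ∀ my → ESpec (sigL i) x my → ESpec (sig i ∘ toList) (x ∷ v) (mapMaybe (_∷ v) my)
e-left i x v εv≤φx nothing  εx≡0 = ε-⊗-zero (sigL i x) (sig i (toList v)) εv≤φx εx≡0
e-left i x v εv≤φx (just y) x⇝y  = ⊗-⇝ˡ εv≤φx x⇝y

f-left : ∀ i x {n} (v : Vec G n) → ε (sig i (toList v)) < φL i x →
         ∀ my → FSpec (sigL i) x my → FSpec (sig i ∘ toList) (x ∷ v) (mapMaybe (_∷ v) my)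
f-left i x v εv<φx nothing  φx≡0 = contradiction (subst (ε (sig i (toList v)) <_) φx≡0 εv<φx) n≮0
f-left i x v εv<φx (just y) y⇝x  = ⊗-⇝ˡ (s≤s⁻¹ (subst (ε (sig i (toList v)) <_) (proj₂ y⇝x) εv<φx)) y⇝x

e-step : ∀ i x {n} (v : Vec G n) m → ESpec (sig i ∘ toList) v m →
         ∀ {b} → Reflects (φL i x < ε (sig i (toList v))) b →
         ESpec (sig i ∘ toList) (x ∷ v) (if b then mapMaybe (x ∷_) m else mapMaybe (_∷ v) (eL i x))
e-step i x v nothing   εv≡0 (ofʸ φx<εv) = contradiction (subst (φL i x <_) εv≡0 φx<εv) n≮0
e-step i x v (just v′) v⇝v′ (ofʸ φx<εv) = ⊗-⇝ʳ φx<εv v⇝v′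
e-step i x v m _ (ofⁿ φx≮εv) = e-left i x v (≮⇒≥ φx≮εv) (eL i x) (eL-spec i x)

f-step : ∀ i x {n} (v : Vec G n) m → FSpec (sig i ∘ toList) v m →
         ∀ {b} → Reflects (ε (sig i (toList v)) < φL i x) b →
         FSpec (sig i ∘ toList) (x ∷ v) (if b then mapMaybe (_∷ v) (fL i x) else mapMaybe (x ∷_) m)
f-step i x v m _ (ofʸ εv<φx) = f-left i x v εv<φx (fL i x) (fL-spec i x)
f-step i x v nothing   φv≡0 (ofⁿ εv≮φx) = φ-⊗-zero (sigL i x) (sig i (toList v)) (≮⇒≥ εv≮φx) φv≡0
f-step i x v (just v′) v′⇝v (ofⁿ εv≮φx) =
  ⊗-⇝ʳ (subst (suc (φL i x) ≤_) (sym (proj₁ v′⇝v)) (s≤s (≮⇒≥ εv≮φx))) v′⇝v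

iterE-correct : ∀ {n} i → (∀ v → ESpec (sig i ∘ toList) v (eV n i v)) →
                ∀ k (v : Vec G n) → iterE n i k v ≡ k ⊓ ε (sig i (toList v))
iterE-correct i spec zero v = refl
iterE-correct {n} i spec (suc k) v with eV n i v | spec v
... | nothing | εv≡0 rewrite εv≡0 = refl
... | just v′ | (εv≡ , _) rewrite εv≡ = cong suc (iterE-correct i spec k v′)

mutual
  eV-spec : ∀ n i (v : Vec G n) → ESpec (sig i ∘ toList) v (eV n i v)
  eV-spec zero    i []      = refl
  eV-spec (suc n) i (x ∷ v) = e-step i x v (eV n i v) (eV-spec n i v)
    (subst (λ e → Reflects (φL i x < e) (φL i x <ᵇ εV n i v)) (εV-correct n i v) (<ᵇ-reflects-< (φL i x) (εV n i v)))

  εV-correct : ∀ n i (v : Vec G n) → εV n i v ≡ ε (sig i (toList v))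
  εV-correct n i v = trans (iterE-correct i (eV-spec n i) (6 * n) v) (m≥n⇒m⊓n≡n (ε-sig-≤ i v))

fV-spec : ∀ n i (v : Vec G n) → FSpec (sig i ∘ toList) v (fV n i v)
fV-spec zero    i []      = refl
fV-spec (suc n) i (x ∷ v) = f-step i x v (fV n i v) (fV-spec n i v)
  (subst (λ e → Reflects (e < φL i x) (εV n i v <ᵇ φL i x)) (εV-correct n i v) (<ᵇ-reflects-< (εV n i v) (φL i x)))

ẽ-spec : ∀ i w → ESpec (sig i) w (ẽ i w)
ẽ-spec i w = subst (λ u → ESpec (sig i) u (ẽ i w)) (toList∘fromList w)
  (ESpec-map toList (eV _ i (fromList w)) (eV-spec _ i (fromList w)))

f̃-spec : ∀ i w → FSpec (sig i) w (f̃ i w)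
f̃-spec i w = subst (λ u → FSpec (sig i) u (f̃ i w)) (toList∘fromList w)
  (FSpec-map toList (fV _ i (fromList w)) (fV-spec _ i (fromList w)))

ẽ-nothing⇒ε≡0 : ∀ i w → ẽ i w ≡ nothing → ε (sig i w) ≡ 0
ẽ-nothing⇒ε≡0 i w eq = subst (ESpec (sig i) w) eq (ẽ-spec i w)

f̃-nothing⇒φ≡0 : ∀ i w → f̃ i w ≡ nothing → φ (sig i w) ≡ 0
f̃-nothing⇒φ≡0 i w eq = subst (FSpec (sig i) w) eq (f̃-spec i w)

f̃-just⇒φ≡suc : ∀ i w {w′} → f̃ i w ≡ just w′ → φ (sig i w) ≡ suc (φ (sig i w′))
f̃-just⇒φ≡suc i w eq = proj₂ (subst (FSpec (sig i) w) eq (f̃-spec i w))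

-- Crystal isomorphisms

module _ {w₁ w₂ F} (iso : CrystalIso w₁ w₂ F) where
  open CrystalIso iso

  CrystalIso-φ : ∀ i m {u} → InB w₁ u → φ (sig i u) ≡ m → φ (sig i (F u)) ≡ m
  CrystalIso-φ i zero {u} u∈ φu≡0 with f̃ i u in eq
  ... | nothing = f̃-nothing⇒φ≡0 i (F u) (trans (f-comm i u u∈) (cong (mapMaybe F) eq))
  ... | just _  = contradiction (trans (sym φu≡0) (f̃-just⇒φ≡suc i u eq)) 0≢1+n
  CrystalIso-φ i (suc m) {u} u∈ φu≡ with f̃ i u in eq
  ... | nothing = contradiction (trans (sym (f̃-nothing⇒φ≡0 i u eq)) φu≡) 0≢1+n
  ... | just u′ = trans (f̃-just⇒φ≡suc i (F u) (trans (f-comm i u u∈) (cong (mapMaybe F) eq)))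
    (cong suc (CrystalIso-φ i m (viaF i u∈ eq) (suc-injective (trans (sym (f̃-just⇒φ≡suc i u eq)) φu≡))))

  CrystalIso-ẽ-nothing : ∀ i → ẽ i w₁ ≡ nothing → ẽ i w₂ ≡ nothing
  CrystalIso-ẽ-nothing i eq = subst (λ v → ẽ i v ≡ nothing) sends (trans (e-comm i w₁ here) (cong (mapMaybe F) eq))

∼-φ : ∀ {w w′} → w ∼ w′ → ∀ i → φ (sig i w′) ≡ φ (sig i w)
∼-φ {w} (F , iso) i = subst (λ v → φ (sig i v) ≡ φ (sig i w)) (CrystalIso.sends iso) (CrystalIso-φ iso i _ here refl)

∼-highestWeight : ∀ {w w′} → w ∼ w′ → HighestWeight w → HighestWeight w′
∼-highestWeight (_ , iso) (e₁ , e₂) = CrystalIso-ẽ-nothing iso α1 e₁ , CrystalIso-ẽ-nothing iso α2 e₂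

-- Crystal isomorphisms given by finite tables

fromIdx : ℕ → G
fromIdx 0 = g1
fromIdx 1 = g2
fromIdx 2 = g3
fromIdx 3 = g0
fromIdx 4 = g3b
fromIdx 5 = g2b
fromIdx _ = g1b

fromIdx-idx : ∀ a → fromIdx (idx a) ≡ a
fromIdx-idx g1  = refl
fromIdx-idx g2  = refl
fromIdx-idx g3  = refl
fromIdx-idx g0  = refl
fromIdx-idx g3b = refl
fromIdx-idx g2b = refl
fromIdx-idx g1b = refl

idx-injective : ∀ {a b} → idx a ≡ idx b → a ≡ b
idx-injective {a} {b} eq = trans (sym (fromIdx-idx a)) (trans (cong fromIdx eq) (fromIdx-idx b))

_≟G_ : DecidableEquality G
a ≟G b = map′ idx-injective (cong idx) (idx a ≟ idx b)

_≟W_ : DecidableEquality Word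
_≟W_ = List.≡-dec _≟G_

_≟M_ : DecidableEquality (Maybe Word)
_≟M_ = Maybe.≡-dec _≟W_

∀I? : {P : I → Set} → (∀ i → Dec (P i)) → Dec (∀ i → P i)
∀I? P? = map′ (λ (p₁ , p₂) → both p₁ p₂) (λ p → p α1 , p α2) (P? α1 ×-dec P? α2)
  where
  both : ∀ {P : I → Set} → P α1 → P α2 → ∀ i → P i
  both p₁ _ α1 = p₁
  both _ p₂ α2 = p₂

lookupOr : List (Word × Word) → Word → Word
lookupOr []            w = w
lookupOr ((a , b) ∷ t) w = if does (a ≟W w) then b else lookupOr t w

module TableIso (table : List (Word × Word)) where
  open import Data.List.Membership.DecPropositional _≟W_ using (_∈?_)

  apply unapply : Word → Word
  apply   = lookupOr table
  unapply = lookupOr (map swap table)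

  domain : List Word
  domain = map proj₁ table

  Closed : Word → Set
  Closed u = ∀ i → MaybeAll (_∈ domain) (ẽ i u) × MaybeAll (_∈ domain) (f̃ i u)

  closed? : ∀ u → Dec (Closed u)
  closed? u = ∀I? λ i → MaybeAll.dec (_∈? domain) (ẽ i u) ×-dec MaybeAll.dec (_∈? domain) (f̃ i u)

  Commutes : Word → Set
  Commutes u = (∀ i → ẽ i (apply u) ≡ mapMaybe apply (ẽ i u) × f̃ i (apply u) ≡ mapMaybe apply (f̃ i u))
             × unapply (apply u) ≡ u

  commutes? : ∀ u → Dec (Commutes u)
  commutes? u = ∀I? (λ i → (ẽ i (apply u) ≟M mapMaybe apply (ẽ i u))
                           ×-dec (f̃ i (apply u) ≟M mapMaybe apply (f̃ i u)))
                ×-dec (unapply (apply u) ≟W u)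

  module _ {w₁ w₂} (w₁∈ : w₁ ∈ domain) (closed : All Closed domain) (commutes : All Commutes domain)
           (sends : apply w₁ ≡ w₂) where

    ⊆-domain : ∀ {u} → InB w₁ u → u ∈ domain
    ⊆-domain here = w₁∈
    ⊆-domain (viaE i u∈ eq) =
      MaybeAll.drop-just (subst (MaybeAll (_∈ domain)) eq (proj₁ (All.lookup closed (⊆-domain u∈) i)))
    ⊆-domain (viaF i u∈ eq) =
      MaybeAll.drop-just (subst (MaybeAll (_∈ domain)) eq (proj₂ (All.lookup closed (⊆-domain u∈) i)))

    e-comm : ∀ i u → InB w₁ u → ẽ i (apply u) ≡ mapMaybe apply (ẽ i u)
    e-comm i u u∈ = proj₁ (proj₁ (All.lookup commutes (⊆-domain u∈)) i)

    f-comm : ∀ i u → InB w₁ u → f̃ i (apply u) ≡ mapMaybe apply (f̃ i u)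
    f-comm i u u∈ = proj₂ (proj₁ (All.lookup commutes (⊆-domain u∈)) i)

    unapply-apply : ∀ {u} → InB w₁ u → unapply (apply u) ≡ u
    unapply-apply u∈ = proj₂ (All.lookup commutes (⊆-domain u∈))

    into : ∀ u → InB w₁ u → InB w₂ (apply u)
    into u here = subst (InB w₂) (sym sends) here
    into v (viaE {u} i u∈ eq) = viaE i (into u u∈) (trans (e-comm i u u∈) (cong (mapMaybe apply) eq))
    into v (viaF {u} i u∈ eq) = viaF i (into u u∈) (trans (f-comm i u u∈) (cong (mapMaybe apply) eq))

    surj : ∀ v → InB w₂ v → Σ Word (λ u → InB w₁ u × apply u ≡ v)
    surj v here = w₁ , here , sends
    surj v (viaE {v′} i v′∈ eq) with surj v′ v′∈
    ... | u , u∈ , refl with ẽ i u in eu | e-comm i u u∈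
    ...   | nothing | c = contradiction (trans (sym eq) c) λ ()
    ...   | just u′ | c = u′ , viaE i u∈ eu , just-injective (trans (sym c) eq)
    surj v (viaF {v′} i v′∈ eq) with surj v′ v′∈
    ... | u , u∈ , refl with f̃ i u in eu | f-comm i u u∈
    ...   | nothing | c = contradiction (trans (sym eq) c) λ ()
    ...   | just u′ | c = u′ , viaF i u∈ eu , just-injective (trans (sym c) eq)

    crystalIso : CrystalIso w₁ w₂ apply
    crystalIso = record
      { into   = into
      ; sends  = sends
      ; inj    = λ u u′ u∈ u′∈ eq → trans (sym (unapply-apply u∈)) (trans (cong unapply eq) (unapply-apply u′∈))
      ; surj   = surj
      ; e-comm = e-comm
      ; f-comm = f-comm
      }

-- The vertices of B(121), resp. B(123), paired with their images in B(112), resp. B(110).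
table₃ : List (Word × Word)
table₃ =
  ((g1 ∷ g2 ∷ g1 ∷ []) , (g1 ∷ g1 ∷ g2 ∷ []))
  ∷ ((g1 ∷ g2 ∷ g2 ∷ []) , (g2 ∷ g1 ∷ g2 ∷ []))
  ∷ ((g1 ∷ g3 ∷ g1 ∷ []) , (g1 ∷ g1 ∷ g3 ∷ []))
  ∷ ((g2 ∷ g3 ∷ g1 ∷ []) , (g2 ∷ g1 ∷ g3 ∷ []))
  ∷ ((g2 ∷ g0 ∷ g1 ∷ []) , (g2 ∷ g2 ∷ g3 ∷ []))
  ∷ ((g2 ∷ g3b ∷ g1 ∷ []) , (g2 ∷ g2 ∷ g0 ∷ []))
  ∷ ((g3 ∷ g0 ∷ g1 ∷ []) , (g3 ∷ g2 ∷ g3 ∷ []))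
  ∷ ((g0 ∷ g0 ∷ g1 ∷ []) , (g0 ∷ g2 ∷ g3 ∷ []))
  ∷ ((g0 ∷ g3b ∷ g1 ∷ []) , (g0 ∷ g2 ∷ g0 ∷ []))
  ∷ ((g0 ∷ g3b ∷ g2 ∷ []) , (g0 ∷ g2 ∷ g3b ∷ []))
  ∷ ((g0 ∷ g2b ∷ g1 ∷ []) , (g0 ∷ g3 ∷ g0 ∷ []))
  ∷ ((g3 ∷ g2b ∷ g1 ∷ []) , (g3 ∷ g3 ∷ g0 ∷ []))
  ∷ ((g3b ∷ g2b ∷ g1 ∷ []) , (g3b ∷ g3 ∷ g0 ∷ []))
  ∷ ((g3b ∷ g1b ∷ g1 ∷ []) , (g3b ∷ g0 ∷ g0 ∷ []))
  ∷ ((g3b ∷ g1b ∷ g2 ∷ []) , (g3b ∷ g0 ∷ g3b ∷ []))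
  ∷ ((g2b ∷ g1b ∷ g1 ∷ []) , (g2b ∷ g0 ∷ g0 ∷ []))
  ∷ ((g2b ∷ g1b ∷ g2 ∷ []) , (g2b ∷ g0 ∷ g3b ∷ []))
  ∷ ((g2b ∷ g1b ∷ g3 ∷ []) , (g2b ∷ g0 ∷ g2b ∷ []))
  ∷ ((g2b ∷ g1b ∷ g0 ∷ []) , (g2b ∷ g3b ∷ g2b ∷ []))
  ∷ ((g2b ∷ g1b ∷ g3b ∷ []) , (g2b ∷ g3b ∷ g1b ∷ []))
  ∷ ((g3b ∷ g1b ∷ g0 ∷ []) , (g3b ∷ g3b ∷ g2b ∷ []))
  ∷ ((g3b ∷ g1b ∷ g3 ∷ []) , (g3b ∷ g0 ∷ g2b ∷ []))
  ∷ ((g3b ∷ g1b ∷ g3b ∷ []) , (g3b ∷ g3b ∷ g1b ∷ []))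
  ∷ ((g3b ∷ g2b ∷ g3 ∷ []) , (g3b ∷ g3 ∷ g2b ∷ []))
  ∷ ((g0 ∷ g2b ∷ g3 ∷ []) , (g0 ∷ g3 ∷ g2b ∷ []))
  ∷ ((g3b ∷ g2b ∷ g2 ∷ []) , (g3b ∷ g3 ∷ g3b ∷ []))
  ∷ ((g0 ∷ g2b ∷ g2 ∷ []) , (g0 ∷ g3 ∷ g3b ∷ []))
  ∷ ((g3 ∷ g2b ∷ g2 ∷ []) , (g3 ∷ g3 ∷ g3b ∷ []))
  ∷ ((g3 ∷ g3b ∷ g2 ∷ []) , (g3 ∷ g2 ∷ g3b ∷ []))
  ∷ ((g3 ∷ g2b ∷ g3 ∷ []) , (g3 ∷ g3 ∷ g2b ∷ []))
  ∷ ((g3 ∷ g3b ∷ g1 ∷ []) , (g3 ∷ g2 ∷ g0 ∷ []))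
  ∷ ((g2 ∷ g3b ∷ g2 ∷ []) , (g2 ∷ g2 ∷ g3b ∷ []))
  ∷ ((g2b ∷ g1b ∷ g2b ∷ []) , (g2b ∷ g2b ∷ g1b ∷ []))
  ∷ ((g2b ∷ g1b ∷ g1b ∷ []) , (g1b ∷ g2b ∷ g1b ∷ []))
  ∷ ((g3b ∷ g1b ∷ g1b ∷ []) , (g1b ∷ g3b ∷ g1b ∷ []))
  ∷ ((g3b ∷ g1b ∷ g2b ∷ []) , (g1b ∷ g3b ∷ g2b ∷ []))
  ∷ ((g3b ∷ g2b ∷ g2b ∷ []) , (g1b ∷ g0 ∷ g2b ∷ []))
  ∷ ((g0 ∷ g2b ∷ g2b ∷ []) , (g1b ∷ g3 ∷ g2b ∷ []))
  ∷ ((g3b ∷ g2b ∷ g3b ∷ []) , (g1b ∷ g0 ∷ g3b ∷ []))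
  ∷ ((g3b ∷ g2b ∷ g0 ∷ []) , (g1b ∷ g0 ∷ g0 ∷ []))
  ∷ ((g0 ∷ g2b ∷ g0 ∷ []) , (g1b ∷ g3 ∷ g0 ∷ []))
  ∷ ((g3 ∷ g2b ∷ g0 ∷ []) , (g2b ∷ g3 ∷ g0 ∷ []))
  ∷ ((g0 ∷ g3b ∷ g0 ∷ []) , (g1b ∷ g2 ∷ g0 ∷ []))
  ∷ ((g0 ∷ g3b ∷ g3 ∷ []) , (g1b ∷ g2 ∷ g3 ∷ []))
  ∷ ((g0 ∷ g3b ∷ g3b ∷ []) , (g1b ∷ g2 ∷ g3b ∷ []))
  ∷ ((g0 ∷ g2b ∷ g3b ∷ []) , (g1b ∷ g3 ∷ g3b ∷ []))
  ∷ ((g3 ∷ g2b ∷ g3b ∷ []) , (g2b ∷ g3 ∷ g3b ∷ []))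
  ∷ ((g3 ∷ g3b ∷ g3b ∷ []) , (g2b ∷ g2 ∷ g3b ∷ []))
  ∷ ((g3 ∷ g2b ∷ g2b ∷ []) , (g2b ∷ g3 ∷ g2b ∷ []))
  ∷ ((g3 ∷ g3b ∷ g0 ∷ []) , (g2b ∷ g2 ∷ g0 ∷ []))
  ∷ ((g2 ∷ g3b ∷ g3b ∷ []) , (g3b ∷ g2 ∷ g3b ∷ []))
  ∷ ((g2 ∷ g3b ∷ g0 ∷ []) , (g3b ∷ g2 ∷ g0 ∷ []))
  ∷ ((g2 ∷ g3b ∷ g3 ∷ []) , (g3b ∷ g2 ∷ g3 ∷ []))
  ∷ ((g2 ∷ g0 ∷ g3 ∷ []) , (g3b ∷ g1 ∷ g3 ∷ []))
  ∷ ((g3 ∷ g3b ∷ g3 ∷ []) , (g2b ∷ g2 ∷ g3 ∷ []))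
  ∷ ((g2 ∷ g3 ∷ g3 ∷ []) , (g0 ∷ g1 ∷ g3 ∷ []))
  ∷ ((g1 ∷ g3 ∷ g3 ∷ []) , (g3 ∷ g1 ∷ g3 ∷ []))
  ∷ ((g2 ∷ g3 ∷ g2 ∷ []) , (g0 ∷ g1 ∷ g2 ∷ []))
  ∷ ((g1 ∷ g3 ∷ g2 ∷ []) , (g3 ∷ g1 ∷ g2 ∷ []))
  ∷ ((g2 ∷ g0 ∷ g2 ∷ []) , (g3b ∷ g1 ∷ g2 ∷ []))
  ∷ ((g3 ∷ g0 ∷ g2 ∷ []) , (g2b ∷ g1 ∷ g2 ∷ []))
  ∷ ((g0 ∷ g0 ∷ g2 ∷ []) , (g1b ∷ g1 ∷ g2 ∷ []))
  ∷ ((g3 ∷ g0 ∷ g3 ∷ []) , (g2b ∷ g1 ∷ g3 ∷ []))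
  ∷ ((g0 ∷ g0 ∷ g3 ∷ []) , (g1b ∷ g1 ∷ g3 ∷ []))
  ∷ []

table₄ : List (Word × Word)
table₄ =
  ((g1 ∷ g2 ∷ g3 ∷ []) , (g1 ∷ g1 ∷ g0 ∷ []))
  ∷ ((g1 ∷ g2 ∷ g0 ∷ []) , (g2 ∷ g1 ∷ g0 ∷ []))
  ∷ ((g1 ∷ g2 ∷ g3b ∷ []) , (g2 ∷ g1 ∷ g3b ∷ []))
  ∷ ((g1 ∷ g3 ∷ g0 ∷ []) , (g3 ∷ g1 ∷ g0 ∷ []))
  ∷ ((g2 ∷ g3 ∷ g0 ∷ []) , (g0 ∷ g1 ∷ g0 ∷ []))
  ∷ ((g2 ∷ g0 ∷ g0 ∷ []) , (g3b ∷ g1 ∷ g0 ∷ []))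
  ∷ ((g2 ∷ g0 ∷ g3b ∷ []) , (g3b ∷ g1 ∷ g3b ∷ []))
  ∷ ((g3 ∷ g0 ∷ g0 ∷ []) , (g2b ∷ g1 ∷ g0 ∷ []))
  ∷ ((g0 ∷ g0 ∷ g0 ∷ []) , (g1b ∷ g1 ∷ g0 ∷ []))
  ∷ ((g0 ∷ g0 ∷ g3b ∷ []) , (g1b ∷ g1 ∷ g3b ∷ []))
  ∷ ((g0 ∷ g0 ∷ g2b ∷ []) , (g1b ∷ g1 ∷ g2b ∷ []))
  ∷ ((g3 ∷ g0 ∷ g2b ∷ []) , (g2b ∷ g1 ∷ g2b ∷ []))
  ∷ ((g0 ∷ g3b ∷ g2b ∷ []) , (g1b ∷ g2 ∷ g2b ∷ []))
  ∷ ((g0 ∷ g3b ∷ g1b ∷ []) , (g1b ∷ g2 ∷ g1b ∷ []))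
  ∷ ((g0 ∷ g2b ∷ g1b ∷ []) , (g1b ∷ g3 ∷ g1b ∷ []))
  ∷ ((g3 ∷ g2b ∷ g1b ∷ []) , (g2b ∷ g3 ∷ g1b ∷ []))
  ∷ ((g3b ∷ g2b ∷ g1b ∷ []) , (g1b ∷ g0 ∷ g1b ∷ []))
  ∷ ((g3 ∷ g3b ∷ g1b ∷ []) , (g2b ∷ g2 ∷ g1b ∷ []))
  ∷ ((g3 ∷ g3b ∷ g2b ∷ []) , (g2b ∷ g2 ∷ g2b ∷ []))
  ∷ ((g2 ∷ g3b ∷ g1b ∷ []) , (g3b ∷ g2 ∷ g1b ∷ []))
  ∷ ((g2 ∷ g3b ∷ g2b ∷ []) , (g3b ∷ g2 ∷ g2b ∷ []))
  ∷ ((g2 ∷ g0 ∷ g2b ∷ []) , (g3b ∷ g1 ∷ g2b ∷ []))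
  ∷ ((g2 ∷ g3 ∷ g2b ∷ []) , (g0 ∷ g1 ∷ g2b ∷ []))
  ∷ ((g1 ∷ g3 ∷ g2b ∷ []) , (g3 ∷ g1 ∷ g2b ∷ []))
  ∷ ((g2 ∷ g3 ∷ g3b ∷ []) , (g0 ∷ g1 ∷ g3b ∷ []))
  ∷ ((g1 ∷ g3 ∷ g3b ∷ []) , (g3 ∷ g1 ∷ g3b ∷ []))
  ∷ ((g3 ∷ g0 ∷ g3b ∷ []) , (g2b ∷ g1 ∷ g3b ∷ []))
  ∷ []

ξ₃ : CrystalIso (g1 ∷ g2 ∷ g1 ∷ []) (g1 ∷ g1 ∷ g2 ∷ []) (TableIso.apply table₃)
ξ₃ = crystalIso (here refl) (from-yes (all? closed? domain)) (from-yes (all? commutes? domain)) refl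
  where open TableIso table₃

ξ₄ : CrystalIso (g1 ∷ g2 ∷ g3 ∷ []) (g1 ∷ g1 ∷ g0 ∷ []) (TableIso.apply table₄)
ξ₄ = crystalIso (here refl) (from-yes (all? closed? domain)) (from-yes (all? commutes? domain)) refl
  where open TableIso table₄

-- Plactic classes of highest weight words

≡ₚ-setoid : Setoid _ _
≡ₚ-setoid = record
  { Carrier       = Word
  ; _≈_           = _≡ₚ_
  ; isEquivalence = record { refl = prefl ; sym = psym ; trans = ptrans }
  }

open Relation.Binary.Reasoning.Setoid ≡ₚ-setoid

++-congˡ : ∀ x {u v} → u ≡ₚ v → (x ++ u) ≡ₚ (x ++ v)
++-congˡ x {u} {v} u≡ₚv =
  subst₂ _≡ₚ_ (cong (x ++_) (++-identityʳ u)) (cong (x ++_) (++-identityʳ v)) (pctx x [] u≡ₚv)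

121≡ₚ112 : ∀ s → (g1 ∷ g2 ∷ g1 ∷ s) ≡ₚ (g1 ∷ g1 ∷ g2 ∷ s)
121≡ₚ112 s = pctx [] s (gen (r3 _ ξ₃ _ here))

123≡ₚ110 : ∀ s → (g1 ∷ g2 ∷ g3 ∷ s) ≡ₚ (g1 ∷ g1 ∷ g0 ∷ s)
123≡ₚ110 s = pctx [] s (gen (r4 _ ξ₄ _ here))

ones : ℕ → Word
ones zero    = []
ones (suc a) = g1 ∷ ones a

onetwos : ℕ → Word
onetwos zero    = []
onetwos (suc b) = g1 ∷ g2 ∷ onetwos b

-- 1^a (12)^b, the reading of the highest weight tableau of shape aΛ₁ + bΛ₂.
highest : ℕ → ℕ → Word
highest a b = ones a ++ onetwos b

ones-snoc : ∀ a s → ones a ++ g1 ∷ s ≡ g1 ∷ ones a ++ s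
ones-snoc zero    s = refl
ones-snoc (suc a) s = cong (g1 ∷_) (ones-snoc a s)

onetwos-snoc : ∀ b s → onetwos b ++ g1 ∷ g2 ∷ s ≡ g1 ∷ g2 ∷ onetwos b ++ s
onetwos-snoc zero    s = refl
onetwos-snoc (suc b) s = cong (λ u → g1 ∷ g2 ∷ u) (onetwos-snoc b s)

onetwos-one : ∀ b s → (onetwos b ++ g1 ∷ s) ≡ₚ (g1 ∷ onetwos b ++ s)
onetwos-one zero    s = prefl
onetwos-one (suc b) s = ptrans (++-congˡ (g1 ∷ g2 ∷ []) (onetwos-one b s)) (121≡ₚ112 (onetwos b ++ s))

module _ (a b : ℕ) where

  push-one : ∀ s → (ones a ++ onetwos b ++ g1 ∷ s) ≡ₚ (ones (suc a) ++ onetwos b ++ s)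
  push-one s = begin
    ones a ++ onetwos b ++ g1 ∷ s   ≈⟨ ++-congˡ (ones a) (onetwos-one b s) ⟩
    ones a ++ g1 ∷ onetwos b ++ s   ≡⟨ ones-snoc a (onetwos b ++ s) ⟩
    ones (suc a) ++ onetwos b ++ s  ∎

  push-onetwo : ∀ s → ones a ++ onetwos b ++ g1 ∷ g2 ∷ s ≡ ones a ++ onetwos (suc b) ++ s
  push-onetwo s = cong (ones a ++_) (onetwos-snoc b s)

  after-highest : ∀ {u v} → u ≡ₚ v → (ones a ++ onetwos b ++ u) ≡ₚ (ones a ++ onetwos b ++ v)
  after-highest u≡ₚv = ++-congˡ (ones a) (++-congˡ (onetwos b) u≡ₚv)

letter-step : ∀ x a b → εL α1 x ≤ a → εL α2 x ≤ b → ∀ s →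
  (ones a ++ onetwos b ++ x ∷ s) ≡ₚ (ones (φL α1 x + (a ∸ εL α1 x)) ++ onetwos (φL α2 x + (b ∸ εL α2 x)) ++ s)
letter-step g1 a b _ _ s = push-one a b s
letter-step g2 (suc a) b _ _ s = begin
  ones (suc a) ++ onetwos b ++ g2 ∷ s  ≈⟨ push-one a b (g2 ∷ s) ⟨
  ones a ++ onetwos b ++ g1 ∷ g2 ∷ s   ≡⟨ push-onetwo a b s ⟩
  ones a ++ onetwos (suc b) ++ s       ∎
letter-step g3 a (suc b) _ _ s = begin
  ones a ++ onetwos (suc b) ++ g3 ∷ s      ≡⟨ push-onetwo a b (g3 ∷ s) ⟨
  ones a ++ onetwos b ++ g1 ∷ g2 ∷ g3 ∷ s  ≈⟨ after-highest a b (123≡ₚ110 s) ⟩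
  ones a ++ onetwos b ++ g1 ∷ g1 ∷ g0 ∷ s  ≈⟨ after-highest a b (pctx (g1 ∷ []) s (gen r1a)) ⟩
  ones a ++ onetwos b ++ g1 ∷ g1 ∷ s       ≈⟨ push-one a b (g1 ∷ s) ⟩
  ones (suc a) ++ onetwos b ++ g1 ∷ s      ≈⟨ push-one (suc a) b s ⟩
  ones (suc (suc a)) ++ onetwos b ++ s     ∎
letter-step g0 (suc a) b _ _ s = begin
  ones (suc a) ++ onetwos b ++ g0 ∷ s  ≈⟨ push-one a b (g0 ∷ s) ⟨
  ones a ++ onetwos b ++ g1 ∷ g0 ∷ s   ≈⟨ after-highest a b (pctx [] s (gen r1a)) ⟩
  ones a ++ onetwos b ++ g1 ∷ s        ≈⟨ push-one a b s ⟩
  ones (suc a) ++ onetwos b ++ s       ∎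
letter-step g3b (suc (suc a)) b _ _ s = begin
  ones (suc (suc a)) ++ onetwos b ++ g3b ∷ s  ≈⟨ push-one (suc a) b (g3b ∷ s) ⟨
  ones (suc a) ++ onetwos b ++ g1 ∷ g3b ∷ s   ≈⟨ push-one a b (g1 ∷ g3b ∷ s) ⟨
  ones a ++ onetwos b ++ g1 ∷ g1 ∷ g3b ∷ s    ≈⟨ after-highest a b (pctx (g1 ∷ []) s (gen r1b)) ⟩
  ones a ++ onetwos b ++ g1 ∷ g2 ∷ s          ≡⟨ push-onetwo a b s ⟩
  ones a ++ onetwos (suc b) ++ s              ∎
letter-step g2b a (suc b) _ _ s = begin
  ones a ++ onetwos (suc b) ++ g2b ∷ s       ≡⟨ push-onetwo a b (g2b ∷ s) ⟨
  ones a ++ onetwos b ++ g1 ∷ g2 ∷ g2b ∷ s   ≈⟨ after-highest a b (pctx (g1 ∷ []) s (gen r1d)) ⟩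
  ones a ++ onetwos b ++ g1 ∷ g0 ∷ s         ≈⟨ after-highest a b (pctx [] s (gen r1a)) ⟩
  ones a ++ onetwos b ++ g1 ∷ s              ≈⟨ push-one a b s ⟩
  ones (suc a) ++ onetwos b ++ s             ∎
letter-step g1b (suc a) b _ _ s = begin
  ones (suc a) ++ onetwos b ++ g1b ∷ s  ≈⟨ push-one a b (g1b ∷ s) ⟨
  ones a ++ onetwos b ++ g1 ∷ g1b ∷ s   ≈⟨ after-highest a b (pctx [] s (gen r2)) ⟩
  ones a ++ onetwos b ++ s              ∎
letter-step g2  zero       _    ()        _  _
letter-step g3  _          zero _         () _
letter-step g0  zero       _    ()        _  _
letter-step g3b zero       _    ()        _  _
letter-step g3b (suc zero) _    (s≤s ())  _  _
letter-step g2b _          zero _         () _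
letter-step g1b zero       _    ()        _  _

εL-≤ : ∀ i x a t → ε (⟨ 0 , a ⟩ ⊗ sigL i x ⊗ t) ≡ 0 → εL i x ≤ a
εL-≤ i x a t h = m∸n≡0⇒m≤n (ε-prefix-zero ⟨ 0 , a ⟩ (sigL i x) t h)

highest-++ : ∀ a b v → ε (⟨ 0 , a ⟩ ⊗ sig α1 v) ≡ 0 → ε (⟨ 0 , b ⟩ ⊗ sig α2 v) ≡ 0 →
  (ones a ++ onetwos b ++ v) ≡ₚ highest (φ (⟨ 0 , a ⟩ ⊗ sig α1 v)) (φ (⟨ 0 , b ⟩ ⊗ sig α2 v))
highest-++ a b [] _ _ = begin
  ones a ++ onetwos b ++ []  ≡⟨ cong (ones a ++_) (++-identityʳ (onetwos b)) ⟩
  highest a b                ∎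
highest-++ a b (x ∷ v) h₁ h₂ = begin
  ones a ++ onetwos b ++ x ∷ v
    ≈⟨ letter-step x a b (εL-≤ α1 x a (sig α1 v) h₁) (εL-≤ α2 x b (sig α2 v) h₂) v ⟩
  ones a′ ++ onetwos b′ ++ v
    ≈⟨ highest-++ a′ b′ v (subst (λ s → ε s ≡ 0) absorb₁ h₁) (subst (λ s → ε s ≡ 0) absorb₂ h₂) ⟩
  highest (φ (⟨ 0 , a′ ⟩ ⊗ sig α1 v)) (φ (⟨ 0 , b′ ⟩ ⊗ sig α2 v))
    ≡⟨ cong₂ highest (cong φ absorb₁) (cong φ absorb₂) ⟨
  highest (φ (⟨ 0 , a ⟩ ⊗ sig α1 (x ∷ v))) (φ (⟨ 0 , b ⟩ ⊗ sig α2 (x ∷ v))) ∎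
  where
  a′ b′ : ℕ
  a′ = φ (⟨ 0 , a ⟩ ⊗ sigL α1 x)
  b′ = φ (⟨ 0 , b ⟩ ⊗ sigL α2 x)
  absorb₁ : ⟨ 0 , a ⟩ ⊗ sigL α1 x ⊗ sig α1 v ≡ ⟨ 0 , a′ ⟩ ⊗ sig α1 v
  absorb₁ = absorb ⟨ 0 , a ⟩ (sigL α1 x) (sig α1 v) h₁
  absorb₂ : ⟨ 0 , b ⟩ ⊗ sigL α2 x ⊗ sig α2 v ≡ ⟨ 0 , b′ ⟩ ⊗ sig α2 v
  absorb₂ = absorb ⟨ 0 , b ⟩ (sigL α2 x) (sig α2 v) h₂

highestWeight-≡ₚ-highest : ∀ w → HighestWeight w → w ≡ₚ highest (φ (sig α1 w)) (φ (sig α2 w))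
highestWeight-≡ₚ-highest w (e₁ , e₂) = begin
  w  ≈⟨ highest-++ 0 0 w (ẽ-nothing⇒ε≡0 α1 w e₁) (ẽ-nothing⇒ε≡0 α2 w e₂) ⟩
  highest (φ (⟨ 0 , 0 ⟩ ⊗ sig α1 w)) (φ (⟨ 0 , 0 ⟩ ⊗ sig α2 w))
     ≡⟨ cong₂ highest (cong φ (⊗-identityˡ (sig α1 w))) (cong φ (⊗-identityˡ (sig α2 w))) ⟩
  highest (φ (sig α1 w)) (φ (sig α2 w)) ∎

∼-≡ₚ : ∀ {w w′} → HighestWeight w → w ∼ w′ → w′ ≡ₚ w
∼-≡ₚ {w} {w′} hw w∼w′ = begin
  w′                                       ≈⟨ highestWeight-≡ₚ-highest w′ (∼-highestWeight w∼w′ hw) ⟩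
  highest (φ (sig α1 w′)) (φ (sig α2 w′))  ≡⟨ cong₂ highest (∼-φ w∼w′ α1) (∼-φ w∼w′ α2) ⟩
  highest (φ (sig α1 w)) (φ (sig α2 w))    ≈⟨ highestWeight-≡ₚ-highest w hw ⟨
  w                                        ∎

lemma3p1p5 : (w : Word) → HighestWeight w →
    (λ₁ λ₂ : ℕ) (T : List Col) → IsTableau λ₁ λ₂ T → w ∼ reading T →
    reading T ≡ₚ w
lemma3p1p5 w hw _ _ _ _ = ∼-≡ₚ hw
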